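{- There exists an outerplanar graph that is not $(2,2)$-colorable, i.e., there is an outerplanar graph $G$ such that for every assignment of one of two colors to each vertex of $G$, some monochromatic component is not a star (it contains a cycle or has diameter greater than $2$).
   Context: For integers $\kappa\ge 1$, $\lambda\ge 0$, a graph $G$ is called $(\kappa,\lambda)$-colorable if its vertices can be colored with $\kappa$ colors so that every monochromatic component (a connected component of the subgraph induced by the vertices of one color) is acyclic and has diameter at most $\lambda$. For $\lambda=2$ each monochromatic component is a star (a tree of diameter at most $2$, including a single vertex or a single edge); such a coloring with $\kappa$ colors is called a $\kappa$-star coloring. A graph is outerplanar if it has a planar embedding with all vertices on the outer face. -}

module Defs where

open import Data.Nat using (ℕ; zero; suc; _≤_; _<_)
open import Data.Fin using (Fin; toℕ; inject₁; fromℕ)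
import Data.Fin as F
open import Data.Product using (Σ; ∃; ∃-syntax; _×_; _,_)
open import Data.Empty using (⊥)
open import Function.Bundles using (_↔_; Inverse)
open import Function.Definitions using (Injective)
open import Relation.Binary.PropositionalEquality using (_≡_)
open import Relation.Nullary using (¬_)

record Graph : Set₁ where
  field
    n      : ℕ
    Adj    : Fin n → Fin n → Set
    sym    : ∀ {u v} → Adj u v → Adj v u
    irrefl : ∀ {v} → ¬ Adj v v

module _ (G : Graph) where
  open Graph G

  -- Outerplanar: the vertices can be placed on a circle (cyclic order given by
  -- a bijection pos : vertices ↔ positions) such that the edges, drawn as
  -- chords, pairwise do not cross: there are no edges ab, cd with
  -- pos a < pos c < pos b < pos d.
  Outerplanar : Set
  Outerplanar =
    Σ (Fin n ↔ Fin n) λ pos →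
      let p = λ v → toℕ (Inverse.to pos v) in
      ∀ a b c d → Adj a b → Adj c d →
        ¬ (p a < p c × p c < p b × p b < p d)

  data MonoWalk {κ : ℕ} (col : Fin n → Fin κ) (c : Fin κ) : Fin n → Fin n → ℕ → Set where
    here : ∀ {v} → col v ≡ c → MonoWalk col c v v 0
    step : ∀ {u w x k} → col u ≡ c → Adj u w → MonoWalk col c w x k →
           MonoWalk col c u x (suc k)

  InComp : {κ : ℕ} → (Fin n → Fin κ) → Fin n → Fin n → Set
  InComp col v u = ∃[ k ] MonoWalk col (col v) v u k

  -- A cycle of length m+3 in G: injective vertex sequence, consecutive
  -- vertices adjacent, last adjacent to first.
  record Cycle (m : ℕ) : Set where
    field
      vert  : Fin (suc (suc (suc m))) → Fin n
      inj   : Injective _≡_ _≡_ vert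
      adj   : ∀ (i : Fin (suc (suc m))) → Adj (vert (inject₁ i)) (vert (F.suc i))
      close : Adj (vert (fromℕ (suc (suc m)))) (vert F.zero)

  GoodComponent : {κ : ℕ} → (Fin n → Fin κ) → ℕ → Fin n → Set
  GoodComponent col λ' v =
    (∀ m (C : Cycle m) → ¬ (∀ i → InComp col v (Cycle.vert C i)))
    × (∀ u w → InComp col v u → InComp col v w →
         ∃[ k ] (k ≤ λ' × MonoWalk col (col v) u w k))

  Colorable : ℕ → ℕ → Set
  Colorable κ λ' = ∃[ col ] (∀ v → GoodComponent {κ} col λ' v)

{-# OPTIONS --safe #-}

-- The witness is a maximal outerplanar graph on 12 vertices.  If every monochromatic
-- component of a 2-colouring is a star, then no triangle is monochromatic, and no
-- monochromatic path u a b w can have ends that are non-adjacent and without a common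
-- neighbour of their colour, since u and w would lie at distance 3 in their component.
-- Each of the 2^12 colourings of the graph contains one of these two configurations,
-- which is verified by exhaustive search over an explicit list of candidates.

module Submission where

open import Defs
open import Data.Bool using (Bool; T; T?; _∧_; _∨_)
open import Data.Bool.ListAction using (any)
open import Data.Bool.Properties using (∨-comm)
open import Data.Empty using (⊥-elim)
open import Data.Fin using (Fin; toℕ; #_; zero; suc)
open import Data.Fin.Properties using (all?; _≟_)
open import Data.List using (List; []; _∷_)
open import Data.List.Relation.Unary.Any using (Any; any?; satisfied)
open import Data.Nat using (ℕ; zero; suc; _≤_; _<_; s≤s; _≡ᵇ_)
open import Data.Nat.Properties using (_<?_)
open import Data.Product using (∃; ∃-syntax; _×_; _,_; map₂)
open import Data.Sum using (_⊎_; inj₁; inj₂)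
open import Data.Vec using (Vec; []; _∷_; lookup; tabulate)
open import Data.Vec.Properties using (lookup∘tabulate)
open import Function.Base using (_∘_)
open import Function.Construct.Identity using (↔-id)
open import Function.Definitions using (Injective)
open import Relation.Binary.Definitions using (Decidable)
open import Relation.Binary.PropositionalEquality using (_≡_; _≢_; _≗_; refl; sym; trans; subst)
open import Relation.Nullary using (¬_; Dec)
open import Relation.Nullary.Decidable using (toWitness; map′; ¬?; _×-dec_; _→-dec_)
open import Relation.Unary using (Pred)
import Relation.Unary as U

allVec? : ∀ {k n p} {P : Pred (Vec (Fin k) n) p} → U.Decidable P → Dec (∀ v → P v)
allVec? {n = zero} P? = map′ (λ { p [] → p }) (λ ∀p → ∀p []) (P? [])
allVec? {n = suc n} P? =
  map′ (λ { ∀p (x ∷ v) → ∀p x v }) (λ ∀p x v → ∀p (x ∷ v)) (all? λ x → allVec? λ v → P? (x ∷ v))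

module _ (G : Graph) {κ : ℕ} (col : Fin (Graph.n G) → Fin κ) where
  open Graph G using (n; Adj)

  -- Colour conditions come first, so that deciding these predicates rejects most
  -- candidates without testing adjacency.
  MonoTriangle : Fin n → Fin n → Fin n → Set
  MonoTriangle a b c =
    (col b ≡ col a × col c ≡ col a) × (a ≢ b × b ≢ c × a ≢ c) × (Adj a b × Adj b c × Adj c a)

  FarMonoPath : Fin n → Fin n → Fin n → Fin n → Set
  FarMonoPath u a b w =
    (col a ≡ col u × col b ≡ col u × col w ≡ col u) × (Adj u a × Adj a b × Adj b w) ×
    (u ≢ w × ¬ Adj u w × (∀ x → ¬ (col x ≡ col u × Adj u x × Adj x w)))

  monoTriangle⇒¬acyclic : ∀ {λ' a b c} → MonoTriangle a b c → ¬ GoodComponent G col λ' a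
  monoTriangle⇒¬acyclic {a = a} {b} {c}
    ((b∼a , c∼a) , (a≢b , b≢c , a≢c) , (ab , bc , ca)) (acyclic , _) = acyclic 0 triangle inComp
    where
    vert : Fin 3 → Fin n
    vert = lookup (a ∷ b ∷ c ∷ [])

    vert-injective : Injective _≡_ _≡_ vert
    vert-injective {zero}             {zero}             _ = refl
    vert-injective {zero}             {suc zero}         e = ⊥-elim (a≢b e)
    vert-injective {zero}             {suc (suc zero)}   e = ⊥-elim (a≢c e)
    vert-injective {suc zero}         {zero}             e = ⊥-elim (a≢b (sym e))
    vert-injective {suc zero}         {suc zero}         _ = refl
    vert-injective {suc zero}         {suc (suc zero)}   e = ⊥-elim (b≢c e)
    vert-injective {suc (suc zero)}   {zero}             e = ⊥-elim (a≢c (sym e))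
    vert-injective {suc (suc zero)}   {suc zero}         e = ⊥-elim (b≢c (sym e))
    vert-injective {suc (suc zero)}   {suc (suc zero)}   _ = refl

    triangle : Cycle G 0
    triangle = record
      { vert  = vert
      ; inj   = vert-injective
      ; adj   = λ { zero → ab ; (suc zero) → bc }
      ; close = ca
      }

    inComp : ∀ i → InComp G col a (vert i)
    inComp zero             = 0 , here refl
    inComp (suc zero)       = 1 , step refl ab (here b∼a)
    inComp (suc (suc zero)) = 1 , step refl (Graph.sym G ca) (here c∼a)

  monoWalk≤2⇒near : ∀ {c u w k} → k ≤ 2 → MonoWalk G col c u w k →
                    u ≡ w ⊎ Adj u w ⊎ ∃[ x ] (col x ≡ c × Adj u x × Adj x w)
  monoWalk≤2⇒near _ (here _)                           = inj₁ refl
  monoWalk≤2⇒near _ (step _ ux (here _))               = inj₂ (inj₁ ux)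
  monoWalk≤2⇒near _ (step _ ux (step x∼c xw (here _))) = inj₂ (inj₂ (_ , x∼c , ux , xw))
  monoWalk≤2⇒near (s≤s (s≤s ())) (step _ _ (step _ _ (step _ _ _)))

  farMonoPath⇒¬diam≤2 : ∀ {u a b w} → FarMonoPath u a b w → ¬ GoodComponent G col 2 u
  farMonoPath⇒¬diam≤2 {u} {w = w}
    ((a∼u , b∼u , w∼u) , (ua , ab , bw) , (u≢w , ¬uw , noMid)) (_ , diam≤2)
    with diam≤2 u w (0 , here refl) (3 , step refl ua (step a∼u ab (step b∼u bw (here w∼u))))
  ... | _ , k≤2 , walk with monoWalk≤2⇒near k≤2 walk
  ... | inj₁ u≡w              = u≢w u≡w
  ... | inj₂ (inj₁ uw)        = ¬uw uw
  ... | inj₂ (inj₂ (x , mid)) = noMid x mid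

≗-resp-≡ : ∀ {a b} {A : Set a} {B : Set b} {f g : A → B} → f ≗ g → ∀ {x y} → f x ≡ f y → g x ≡ g y
≗-resp-≡ f≗g {x} {y} e = trans (sym (f≗g x)) (trans e (f≗g y))

data Candidate (n : ℕ) : Set where
  triangle : (a b c : Fin n) → Candidate n
  path     : (u a b w : Fin n) → Candidate n

module _ (G : Graph) {κ : ℕ} where
  open Graph G using (n; Adj)

  Obstructs : (Fin n → Fin κ) → Candidate n → Set
  Obstructs col (triangle a b c) = MonoTriangle G col a b c
  Obstructs col (path u a b w)   = FarMonoPath G col u a b w

  obstructed⇒¬2-star : ∀ {col} → ∃ (Obstructs col) → ¬ (∀ v → GoodComponent G col 2 v)
  obstructed⇒¬2-star {col} (triangle a b c , mono) good = monoTriangle⇒¬acyclic G col mono (good a)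
  obstructed⇒¬2-star {col} (path u a b w   , far)  good = farMonoPath⇒¬diam≤2 G col far (good u)

  obstructs-resp-≗ : ∀ {f g} → f ≗ g → ∀ {cand} → Obstructs f cand → Obstructs g cand
  obstructs-resp-≗ f≗g {triangle a b c} ((b∼a , c∼a) , distinct , adjacent) =
    (≗-resp-≡ f≗g b∼a , ≗-resp-≡ f≗g c∼a) , distinct , adjacent
  obstructs-resp-≗ f≗g {path u a b w} ((a∼u , b∼u , w∼u) , walk , (u≢w , ¬uw , noMid)) =
    (≗-resp-≡ f≗g a∼u , ≗-resp-≡ f≗g b∼u , ≗-resp-≡ f≗g w∼u) , walk ,
    (u≢w , ¬uw , λ x (x∼u , ux , xw) → noMid x (≗-resp-≡ (sym ∘ f≗g) x∼u , ux , xw))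

  module _ (adj? : Decidable Adj) (col : Fin n → Fin κ) where

    obstructs? : U.Decidable (Obstructs col)
    obstructs? (triangle a b c) =
      (col b ≟ col a ×-dec col c ≟ col a) ×-dec
      (¬? (a ≟ b) ×-dec ¬? (b ≟ c) ×-dec ¬? (a ≟ c)) ×-dec
      (adj? a b ×-dec adj? b c ×-dec adj? c a)
    obstructs? (path u a b w) =
      (col a ≟ col u ×-dec col b ≟ col u ×-dec col w ≟ col u) ×-dec
      (adj? u a ×-dec adj? a b ×-dec adj? b w) ×-dec
      (¬? (u ≟ w) ×-dec ¬? (adj? u w) ×-dec
       all? λ x → ¬? (col x ≟ col u ×-dec adj? u x ×-dec adj? x w))

-- The 12-cycle 0 1 … 11 triangulated by the central triangle 3 7 11, the triangles
-- 1 3 11, 3 5 7 and 7 9 11 on its sides, and one ear on each remaining cycle edge.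
edges : List (ℕ × ℕ)
edges =
  (0 , 1) ∷ (1 , 2) ∷ (2 , 3) ∷ (3 , 4) ∷ (4 , 5) ∷ (5 , 6) ∷
  (6 , 7) ∷ (7 , 8) ∷ (8 , 9) ∷ (9 , 10) ∷ (10 , 11) ∷ (0 , 11) ∷
  (3 , 7) ∷ (7 , 11) ∷ (3 , 11) ∷
  (1 , 3) ∷ (1 , 11) ∷ (3 , 5) ∷ (5 , 7) ∷ (7 , 9) ∷ (9 , 11) ∷ []

isEdge : ℕ → ℕ → Bool
isEdge i j = any (λ (k , l) → (i ≡ᵇ k) ∧ (j ≡ᵇ l)) edges

Adjacent : Fin 12 → Fin 12 → Set
Adjacent u v = T (isEdge (toℕ u) (toℕ v) ∨ isEdge (toℕ v) (toℕ u))

adjacent? : Decidable Adjacent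
adjacent? u v = T? _

adjacent-sym : ∀ {u v} → Adjacent u v → Adjacent v u
adjacent-sym {u} {v} = subst T (∨-comm (isEdge (toℕ u) (toℕ v)) (isEdge (toℕ v) (toℕ u)))

adjacent-irreflexive : ∀ v → ¬ Adjacent v v
adjacent-irreflexive = toWitness {a? = all? λ v → ¬? (adjacent? v v)} _

G : Graph
G = record
  { n      = 12
  ; Adj    = Adjacent
  ; sym    = λ {u} {v} → adjacent-sym {u} {v}
  ; irrefl = λ {v} → adjacent-irreflexive v
  }

noCrossings : ∀ a b c d → Adjacent a b → Adjacent c d →
              ¬ (toℕ a < toℕ c × toℕ c < toℕ b × toℕ b < toℕ d)
noCrossings a b c d ab cd crossing = edgesDoNotCross a b ab c d crossing cd
  where
  -- c and d are only enumerated once a b is known to be an edge, which keeps the search small.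
  edgesDoNotCross : ∀ a b → Adjacent a b → ∀ c d →
                    toℕ a < toℕ c × toℕ c < toℕ b × toℕ b < toℕ d → ¬ Adjacent c d
  edgesDoNotCross = toWitness {a? =
    all? λ a → all? λ b → adjacent? a b →-dec all? λ c → all? λ d →
      (toℕ a <? toℕ c ×-dec toℕ c <? toℕ b ×-dec toℕ b <? toℕ d) →-dec ¬? (adjacent? c d)} _

outerplanar : Outerplanar G
outerplanar = ↔-id _ , noCrossings

-- Found by a greedy set-cover search over all 2^12 colourings.
obstructions : List (Candidate 12)
obstructions =
  triangle (# 0) (# 1) (# 11) ∷ triangle (# 1) (# 2) (# 3) ∷ triangle (# 3) (# 7) (# 11) ∷
  triangle (# 3) (# 4) (# 5) ∷ triangle (# 5) (# 6) (# 7) ∷ triangle (# 7) (# 8) (# 9) ∷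
  triangle (# 9) (# 10) (# 11) ∷ path (# 0) (# 1) (# 3) (# 7) ∷ path (# 1) (# 11) (# 7) (# 5) ∷
  path (# 3) (# 11) (# 9) (# 8) ∷ path (# 3) (# 7) (# 9) (# 10) ∷ path (# 6) (# 5) (# 3) (# 11) ∷
  triangle (# 7) (# 9) (# 11) ∷ path (# 8) (# 7) (# 11) (# 10) ∷ path (# 1) (# 11) (# 9) (# 8) ∷
  path (# 4) (# 5) (# 7) (# 9) ∷ triangle (# 1) (# 3) (# 11) ∷ triangle (# 3) (# 5) (# 7) ∷
  path (# 0) (# 11) (# 3) (# 2) ∷ path (# 4) (# 3) (# 7) (# 6) ∷ path (# 0) (# 1) (# 3) (# 5) ∷
  path (# 0) (# 11) (# 7) (# 5) ∷ path (# 1) (# 11) (# 7) (# 6) ∷ path (# 2) (# 1) (# 11) (# 10) ∷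
  path (# 4) (# 5) (# 7) (# 8) ∷ path (# 0) (# 1) (# 3) (# 4) ∷ path (# 0) (# 11) (# 3) (# 4) ∷
  path (# 0) (# 11) (# 3) (# 5) ∷ path (# 0) (# 11) (# 7) (# 6) ∷ path (# 0) (# 11) (# 9) (# 8) ∷
  path (# 1) (# 3) (# 5) (# 6) ∷ path (# 1) (# 3) (# 7) (# 8) ∷ path (# 1) (# 3) (# 7) (# 9) ∷
  path (# 2) (# 1) (# 11) (# 9) ∷ path (# 2) (# 3) (# 5) (# 6) ∷ path (# 2) (# 3) (# 7) (# 8) ∷
  path (# 2) (# 3) (# 7) (# 9) ∷ path (# 2) (# 1) (# 11) (# 7) ∷ path (# 2) (# 3) (# 11) (# 9) ∷
  path (# 2) (# 3) (# 11) (# 10) ∷ path (# 4) (# 5) (# 7) (# 11) ∷ path (# 5) (# 7) (# 9) (# 10) ∷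
  path (# 6) (# 7) (# 9) (# 10) ∷ path (# 4) (# 3) (# 11) (# 9) ∷ path (# 4) (# 3) (# 11) (# 10) ∷
  path (# 5) (# 3) (# 11) (# 9) ∷ path (# 5) (# 3) (# 11) (# 10) ∷ []

everyColouringObstructed : ∀ (v : Vec (Fin 2) 12) → Any (Obstructs G (lookup v)) obstructions
everyColouringObstructed =
  toWitness {a? = allVec? λ v → any? (obstructs? G adjacent? (lookup v)) obstructions} _

lemma1 : ∃[ G ] (Outerplanar G × ¬ Colorable G 2 2)
lemma1 = G , outerplanar , λ (col , good) →
  obstructed⇒¬2-star G (map₂ (obstructs-resp-≗ G (lookup∘tabulate col))
                             (satisfied (everyColouringObstructed (tabulate col)))) good
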